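{- For integers $n,k\ge0$ let $\left\langle n\atop k\right\rangle$ denote the number of $n$-tilings that contain exactly $k$ fences, with $\left\langle 0\atop 0\right\rangle=1$. Then for all integers $n\ge k>0$, \[ \binom{n}{k}=\left\langle n\atop k\right\rangle+\left\langle n-1\atop k-1\right\rangle. \]
   Context: An $n$-tiling is a tiling of a board (a $1\times L$ row of unit cells, for any $L\ge0$) using exactly $n$ tiles, each of which is a square ($1\times1$ tile) or a $(1,1)$-fence. A $(1,1)$-fence is a tile consisting of two $1\times1$ posts separated by a one-cell gap; placed on a board its posts occupy cells $i$ and $i+2$, and the gap cell must be covered by another tile. A tiling covers every cell exactly once. -}

module Defs where

open import Data.Nat using (ℕ; zero; suc; _+_; _<ᵇ_; _≡ᵇ_)
open import Data.Bool using (Bool; true; false; _∧_; if_then_else_)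
open import Data.List using (List; []; _∷_; length; filter; map; concatMap; upTo; foldr)
open import Data.Bool.ListAction using (all)
open import Data.Product using (_×_; _,_; proj₁; proj₂)
open import Relation.Nullary.Decidable using (Dec; yes; no)
open import Data.Bool using (T?)

-- A placed tile: (i , false) is a square on cell i;
-- (i , true) is a (1,1)-fence whose posts occupy cells i and i+2.
Placement : Set
Placement = ℕ × Bool

isFence : Placement → Bool
isFence = proj₂

covers : Placement → ℕ → Bool
covers (i , false) c = c ≡ᵇ i
covers (i , true)  c = (c ≡ᵇ i) Data.Bool.∨ (c ≡ᵇ (i + 2))

coverCount : List Placement → ℕ → ℕ
coverCount ps c = length (filter (λ p → T? (covers p c)) ps)

inBoard : ℕ → Placement → Bool
inBoard L (i , false) = i <ᵇ L
inBoard L (i , true)  = (i + 2) <ᵇ L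

-- canonical (duplicate-free) listing of a set of tiles: starting cells strictly increasing
increasing : List Placement → Bool
increasing [] = true
increasing (p ∷ []) = true
increasing (p ∷ q ∷ ps) = (proj₁ p <ᵇ proj₁ q) ∧ increasing (q ∷ ps)

isTiling : ℕ → List Placement → Bool
isTiling L ps = all (inBoard L) ps ∧ all (λ c → coverCount ps c ≡ᵇ 1) (upTo L)

listsOf : {A : Set} → ℕ → List A → List (List A)
listsOf zero xs = [] ∷ []
listsOf (suc n) xs = concatMap (λ x → map (x ∷_) (listsOf n xs)) xs

placementsOn : ℕ → List Placement
placementsOn L = concatMap (λ i → (i , false) ∷ (i , true) ∷ []) (upTo L)

numFences : List Placement → ℕ
numFences ps = length (filter (λ p → T? (isFence p)) ps)

tilingsOn : ℕ → ℕ → ℕ → List (List Placement)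
tilingsOn n k L = filter (λ ps → T? (increasing ps ∧ isTiling L ps ∧ (numFences ps ≡ᵇ k)))
                         (listsOf n (placementsOn L))

-- An n-tiling covers a board of length at most 2n (each tile covers at most 2 cells),
-- so boards of length L = 0 .. 2n exhaust all n-tilings.
-- ⟨ n , k ⟩ = number of n-tilings (of boards of any length) with exactly k fences.
tilingCount : ℕ → ℕ → ℕ
tilingCount n k = foldr (λ L acc → length (tilingsOn n k L) + acc) 0 (upTo (suc (n + n)))

{-# OPTIONS --safe #-}
-- Scan the board from the left. Its leftmost uncovered cell is covered by a square or by the
-- left post of a fence; after a fence, the cell in its gap comes next and is covered in turn by
-- a square or by the left post of another fence. This gives a two-state recursion (tilings and
-- gapTilings below), and summing over board lengths the totals T and G satisfy
--   T(n+1, k+1) = T(n, k+1) + G(n, k)   and   G(n+1, k+1) = T(n, k+1) + T(n, k).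
-- Hence T(n, k) + T(n-1, k-1) obeys Pascal's rule, with the boundary values of n choose k.
-- To identify the brute-force count of the statement with the recursion, the tiling condition
-- is generalised to the part of the board from some cell on, possibly with its second cell
-- already covered by a fence post.
module Submission where

open import Defs
open import Data.Nat using (ℕ; zero; suc; _+_; _∸_; _<_; _≤_; z≤n; s≤s; _≡ᵇ_)
open import Data.Nat.Properties
open import Data.Nat.Combinatorics using (_C_; nCk+nC[k+1]≡[n+1]C[k+1])
open import Data.Nat.Tactic.RingSolver using (solve-∀)
open import Algebra.Properties.CommutativeSemigroup +-commutativeSemigroup using (interchange)
open import Data.Bool using (Bool; true; false; T; T?; if_then_else_; _∧_)
open import Data.Bool.ListAction using (all)
open import Data.Bool.Properties using (T-∧)
open import Data.Unit using (tt)
open import Data.Empty using (⊥-elim)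
open import Data.Sum using (inj₁; inj₂)
open import Data.Product using (_×_; _,_; proj₁; uncurry)
open import Data.List using (List; []; _∷_; _++_; length; filter; map; concatMap; foldr; applyUpTo; upTo)
open import Data.List.Properties using (length-++; filter-++; filter-≐; filter-none; filter-accept; filter-reject)
open import Data.List.Relation.Unary.All using (All; []; _∷_; all?; universal)
open import Data.List.Relation.Unary.All.Properties using (all⁺; all⁻; applyUpTo⁺₁; applyUpTo⁻)
open import Function using (_∘_; id; const; _⇔_; mk⇔; Equivalence)
open import Level using (0ℓ)
open import Relation.Nullary using (¬_; Dec; yes; does)
open import Relation.Nullary.Decidable using (map′; _×-dec_; _→-dec_)
open import Relation.Unary using (Pred; Decidable; _≐_)
open import Relation.Binary.PropositionalEquality
open ≡-Reasoning

sumTo : ℕ → (ℕ → ℕ) → ℕ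
sumTo zero    f = 0
sumTo (suc m) f = f 0 + sumTo m (λ i → f (suc i))

sumTo-cong : ∀ m {f g : ℕ → ℕ} → (∀ i → f i ≡ g i) → sumTo m f ≡ sumTo m g
sumTo-cong zero    f≗g = refl
sumTo-cong (suc m) f≗g = cong₂ _+_ (f≗g 0) (sumTo-cong m (λ i → f≗g (suc i)))

sumTo-distrib : ∀ m (f g : ℕ → ℕ) → sumTo m (λ i → f i + g i) ≡ sumTo m f + sumTo m g
sumTo-distrib zero    f g = refl
sumTo-distrib (suc m) f g = begin
  f 0 + g 0 + sumTo m (λ i → f (suc i) + g (suc i))
    ≡⟨ cong (f 0 + g 0 +_) (sumTo-distrib m (λ i → f (suc i)) (λ i → g (suc i))) ⟩
  f 0 + g 0 + (sumTo m (λ i → f (suc i)) + sumTo m (λ i → g (suc i)))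
    ≡⟨ interchange (f 0) (g 0) _ _ ⟩
  f 0 + sumTo m (λ i → f (suc i)) + (g 0 + sumTo m (λ i → g (suc i))) ∎

sumTo-zero : ∀ m {f : ℕ → ℕ} → (∀ i → f i ≡ 0) → sumTo m f ≡ 0
sumTo-zero zero    f≗0 = refl
sumTo-zero (suc m) f≗0 = cong₂ _+_ (f≗0 0) (sumTo-zero m (λ i → f≗0 (suc i)))

sumTo-stable : ∀ {m n} (f : ℕ → ℕ) → m ≤ n → (∀ {i} → m ≤ i → f i ≡ 0) → sumTo n f ≡ sumTo m f
sumTo-stable {zero}  {n}     f _         f≥0 = sumTo-zero n (λ i → f≥0 z≤n)
sumTo-stable {suc m} {suc n} f (s≤s m≤n) f≥m =
  cong (f 0 +_) (sumTo-stable (λ i → f (suc i)) m≤n (λ m≤i → f≥m (s≤s m≤i)))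

sumTo-single : ∀ {m i} (f : ℕ → ℕ) → i < m → (∀ {j} → j ≢ i → f j ≡ 0) → sumTo m f ≡ f i
sumTo-single {suc m} {zero}  f _ f≢0 =
  trans (cong (f 0 +_) (sumTo-zero m (λ j → f≢0 (λ ())))) (+-identityʳ (f 0))
sumTo-single {suc m} {suc i} f (s≤s i<m) f≢i =
  trans (cong (_+ sumTo m (λ j → f (suc j))) (f≢i (λ ())))
        (sumTo-single (λ j → f (suc j)) i<m (λ j≢i → f≢i (λ eq → j≢i (suc-injective eq))))

sumOver : {A : Set} → (A → ℕ) → List A → ℕ
sumOver f = foldr (λ x acc → f x + acc) 0

sumOver-++ : {A : Set} (f : A → ℕ) (xs ys : List A) → sumOver f (xs ++ ys) ≡ sumOver f xs + sumOver f ys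
sumOver-++ f []       ys = refl
sumOver-++ f (x ∷ xs) ys = trans (cong (f x +_) (sumOver-++ f xs ys)) (sym (+-assoc (f x) _ _))

sumOver-concatMap : {A B : Set} (f : B → ℕ) (g : A → List B) (xs : List A) →
                    sumOver f (concatMap g xs) ≡ sumOver (λ x → sumOver f (g x)) xs
sumOver-concatMap f g []       = refl
sumOver-concatMap f g (x ∷ xs) =
  trans (sumOver-++ f (g x) (concatMap g xs)) (cong (sumOver f (g x) +_) (sumOver-concatMap f g xs))

sumOver-cong : {A : Set} {f g : A → ℕ} (xs : List A) → (∀ x → f x ≡ g x) → sumOver f xs ≡ sumOver g xs
sumOver-cong []       f≗g = refl
sumOver-cong (x ∷ xs) f≗g = cong₂ _+_ (f≗g x) (sumOver-cong xs f≗g)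

sumOver-applyUpTo : (f h : ℕ → ℕ) (m : ℕ) → sumOver f (applyUpTo h m) ≡ sumTo m (λ i → f (h i))
sumOver-applyUpTo f h zero    = refl
sumOver-applyUpTo f h (suc m) = cong (f (h 0) +_) (sumOver-applyUpTo f (λ i → h (suc i)) m)

sumOver-zero : {A : Set} {f : A → ℕ} (xs : List A) → (∀ x → f x ≡ 0) → sumOver f xs ≡ 0
sumOver-zero []       f≗0 = refl
sumOver-zero (x ∷ xs) f≗0 = cong₂ _+_ (f≗0 x) (sumOver-zero xs f≗0)

module _ {A : Set} {P : Pred A 0ℓ} (P? : Decidable P) where

  length-filter-map : {B : Set} (f : B → A) (ys : List B) →
                      length (filter P? (map f ys)) ≡ length (filter (λ y → P? (f y)) ys)
  length-filter-map f []       = refl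
  length-filter-map f (y ∷ ys) with does (P? (f y))
  ... | true  = cong suc (length-filter-map f ys)
  ... | false = length-filter-map f ys

  length-filter-concatMap : {B : Set} (g : B → List A) (ys : List B) →
                            length (filter P? (concatMap g ys)) ≡ sumOver (λ y → length (filter P? (g y))) ys
  length-filter-concatMap g []       = refl
  length-filter-concatMap g (y ∷ ys) = begin
    length (filter P? (g y ++ concatMap g ys))
      ≡⟨ cong length (filter-++ P? (g y) (concatMap g ys)) ⟩
    length (filter P? (g y) ++ filter P? (concatMap g ys))
      ≡⟨ length-++ (filter P? (g y)) ⟩
    length (filter P? (g y)) + length (filter P? (concatMap g ys))
      ≡⟨ cong (length (filter P? (g y)) +_) (length-filter-concatMap g ys) ⟩
    sumOver (λ y → length (filter P? (g y))) (y ∷ ys) ∎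

countLists : {A : Set} {P : Pred (List A) 0ℓ} → Decidable P → ℕ → List A → ℕ
countLists P? n xs = length (filter P? (listsOf n xs))

module _ {A : Set} {P : Pred (List A) 0ℓ} (P? : Decidable P) where

  countLists-suc : ∀ n xs →
    countLists P? (suc n) xs ≡ sumOver (λ x → countLists (λ ys → P? (x ∷ ys)) n xs) xs
  countLists-suc n xs = begin
    length (filter P? (concatMap (λ x → map (x ∷_) (listsOf n xs)) xs))
      ≡⟨ length-filter-concatMap P? _ xs ⟩
    sumOver (λ x → length (filter P? (map (x ∷_) (listsOf n xs)))) xs
      ≡⟨ sumOver-cong xs (λ x → length-filter-map P? (x ∷_) (listsOf n xs)) ⟩
    sumOver (λ x → countLists (λ ys → P? (x ∷ ys)) n xs) xs ∎

  countLists-none : (∀ ys → ¬ P ys) → ∀ n xs → countLists P? n xs ≡ 0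
  countLists-none ¬P n xs = cong length (filter-none P? (universal ¬P (listsOf n xs)))

  countLists-[] : P [] → ∀ xs → countLists P? 0 xs ≡ 1
  countLists-[] P[] xs = cong length (filter-accept P? P[])

  countLists-¬[] : ¬ P [] → ∀ xs → countLists P? 0 xs ≡ 0
  countLists-¬[] ¬P[] xs = cong length (filter-reject P? ¬P[])

countLists-¬∷ : {A : Set} {P : Pred (List A) 0ℓ} (P? : Decidable P) →
               (∀ {x ys} → ¬ P (x ∷ ys)) → ∀ n xs → countLists P? (suc n) xs ≡ 0
countLists-¬∷ P? ¬P∷ n xs =
  trans (countLists-suc P? n xs) (sumOver-zero xs (λ x → countLists-none _ (λ ys → ¬P∷) n xs))

countLists-≐ : {A : Set} {P Q : Pred (List A) 0ℓ} (P? : Decidable P) (Q? : Decidable Q) →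
               P ≐ Q → ∀ n xs → countLists P? n xs ≡ countLists Q? n xs
countLists-≐ P? Q? P≐Q n xs = cong length (filter-≐ P? Q? P≐Q (listsOf n xs))

countLists-startingAt : ∀ {L o} {P : Pred (List Placement) 0ℓ} (P? : Decidable P) →
  o < L → (∀ {p ys} → P (p ∷ ys) → proj₁ p ≡ o) → ∀ n →
  countLists P? (suc n) (placementsOn L) ≡
    countLists (λ ys → P? ((o , false) ∷ ys)) n (placementsOn L) +
    countLists (λ ys → P? ((o , true) ∷ ys)) n (placementsOn L)
countLists-startingAt {L} {o} P? o<L startsAt n = begin
  countLists P? (suc n) (placementsOn L)
    ≡⟨ countLists-suc P? n (placementsOn L) ⟩
  sumOver firstTile (placementsOn L)
    ≡⟨ sumOver-concatMap firstTile (λ i → (i , false) ∷ (i , true) ∷ []) (upTo L) ⟩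
  sumOver firstCell (upTo L)
    ≡⟨ sumOver-applyUpTo firstCell id L ⟩
  sumTo L firstCell
    ≡⟨ sumTo-single firstCell o<L (λ i≢o → cong₂ _+_ (elsewhere i≢o) (cong (_+ 0) (elsewhere i≢o))) ⟩
  firstTile (o , false) + (firstTile (o , true) + 0)
    ≡⟨ cong (firstTile (o , false) +_) (+-identityʳ _) ⟩
  firstTile (o , false) + firstTile (o , true) ∎
  where
  firstTile : Placement → ℕ
  firstTile p = countLists (λ ys → P? (p ∷ ys)) n (placementsOn L)
  firstCell : ℕ → ℕ
  firstCell i = firstTile (i , false) + (firstTile (i , true) + 0)
  elsewhere : ∀ {i b} → i ≢ o → firstTile (i , b) ≡ 0
  elsewhere i≢o = countLists-none _ (λ ys P[p∷ys] → i≢o (startsAt P[p∷ys])) n (placementsOn L)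

-- tilings d n k counts the n-tilings of the 1×d board with k fences; gapTilings d n k counts
-- them on a 1×d board whose cell 1 is already covered by the right post of an uncounted fence
-- whose left post lies just before cell 0.
mutual
  tilings : ℕ → ℕ → ℕ → ℕ
  tilings zero    zero    zero    = 1
  tilings zero    zero    (suc k) = 0
  tilings zero    (suc n) k       = 0
  tilings (suc d) zero    k       = 0
  tilings (suc d) (suc n) zero    = tilings d n zero
  tilings (suc d) (suc n) (suc k) = tilings d n (suc k) + gapTilings d n k

  gapTilings : ℕ → ℕ → ℕ → ℕ
  gapTilings zero                n       k       = 0
  gapTilings (suc zero)          n       k       = 0
  gapTilings (suc (suc d))       zero    k       = 0
  gapTilings (suc (suc d))       (suc n) zero    = tilings d n zero
  gapTilings (suc (suc zero))    (suc n) (suc k) = tilings zero n (suc k)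
  gapTilings (suc (suc (suc d))) (suc n) (suc k) = tilings (suc d) n (suc k) + tilings d n k

mutual
  tilings-vanish : ∀ {d} n k → n + n < d → tilings d n k ≡ 0
  tilings-vanish {suc d} zero    k       _ = refl
  tilings-vanish {suc d} (suc n) zero    (s≤s n+1+n<d) =
    tilings-vanish n zero (<-trans (n<1+n (n + n)) (subst (_< d) (+-suc n n) n+1+n<d))
  tilings-vanish {suc d} (suc n) (suc k) (s≤s n+1+n<d) =
    cong₂ _+_ (tilings-vanish n (suc k) (<-trans (n<1+n (n + n)) n+n+1<d))
              (gapTilings-vanish n k n+n+1<d)
    where n+n+1<d = subst (_< d) (+-suc n n) n+1+n<d

  gapTilings-vanish : ∀ {d} n k → suc (n + n) < d → gapTilings d n k ≡ 0
  gapTilings-vanish {suc zero}    zero    k       (s≤s ())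
  gapTilings-vanish {suc (suc d)} zero    k       _ = refl
  gapTilings-vanish {suc (suc d)} (suc n) zero    (s≤s (s≤s n+1+n<d)) =
    tilings-vanish n zero (<-trans (n<1+n (n + n)) (subst (_< d) (+-suc n n) n+1+n<d))
  gapTilings-vanish {suc (suc (suc d))} (suc n) (suc k) (s≤s (s≤s (s≤s n+1+n<d))) =
    cong₂ _+_ (tilings-vanish n (suc k) (m<n⇒m<1+n n+n<d)) (tilings-vanish n k n+n<d)
    where n+n<d = subst (_≤ d) (+-suc n n) n+1+n<d

total : ℕ → ℕ → ℕ
total n k = sumTo (suc (n + n)) (λ d → tilings d n k)

gapTotal : ℕ → ℕ → ℕ
gapTotal n k = sumTo (suc (suc (n + n))) (λ d → gapTilings d n k)

total-stable : ∀ {m} n k → suc (n + n) ≤ m → sumTo m (λ d → tilings d n k) ≡ total n k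
total-stable n k bound = sumTo-stable _ bound (tilings-vanish n k)

gapTotal-stable : ∀ {m} n k → suc (suc (n + n)) ≤ m → sumTo m (λ d → gapTilings d n k) ≡ gapTotal n k
gapTotal-stable n k bound = sumTo-stable _ bound (gapTilings-vanish n k)

2n+1≤n+[n+1] : ∀ n → suc (n + n) ≤ n + suc n
2n+1≤n+[n+1] n = ≤-reflexive (sym (+-suc n n))

total-suc-zero : ∀ n → total (suc n) zero ≡ total n zero
total-suc-zero n = total-stable n zero (m≤n⇒m≤1+n (2n+1≤n+[n+1] n))

total-suc-suc : ∀ n k → total (suc n) (suc k) ≡ total n (suc k) + gapTotal n k
total-suc-suc n k = begin
  sumTo (suc (n + suc n)) (λ d → tilings d n (suc k) + gapTilings d n k)
    ≡⟨ sumTo-distrib (suc (n + suc n)) (λ d → tilings d n (suc k)) (λ d → gapTilings d n k) ⟩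
  sumTo (suc (n + suc n)) (λ d → tilings d n (suc k)) + sumTo (suc (n + suc n)) (λ d → gapTilings d n k)
    ≡⟨ cong₂ _+_ (total-stable n (suc k) (m≤n⇒m≤1+n (2n+1≤n+[n+1] n)))
                 (gapTotal-stable n k (s≤s (2n+1≤n+[n+1] n))) ⟩
  total n (suc k) + gapTotal n k ∎

gapTotal-suc-zero : ∀ n → gapTotal (suc n) zero ≡ total n zero
gapTotal-suc-zero n = total-stable n zero (m≤n⇒m≤1+n (2n+1≤n+[n+1] n))

gapTotal-suc-suc : ∀ n k → gapTotal (suc n) (suc k) ≡ total n (suc k) + total n k
gapTotal-suc-suc n k = begin
  tilings 0 n (suc k) + sumTo m (λ d → tilings (suc d) n (suc k) + tilings d n k)
    ≡⟨ cong (tilings 0 n (suc k) +_) (sumTo-distrib m (λ d → tilings (suc d) n (suc k)) (λ d → tilings d n k)) ⟩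
  tilings 0 n (suc k) + (sumTo m (λ d → tilings (suc d) n (suc k)) + sumTo m (λ d → tilings d n k))
    ≡⟨ +-assoc (tilings 0 n (suc k)) _ _ ⟨
  sumTo (suc m) (λ d → tilings d n (suc k)) + sumTo m (λ d → tilings d n k)
    ≡⟨ cong₂ _+_ (total-stable n (suc k) (m≤n⇒m≤1+n (2n+1≤n+[n+1] n)))
                 (total-stable n k (2n+1≤n+[n+1] n)) ⟩
  total n (suc k) + total n k ∎
  where m = n + suc n

total-zero : ∀ n → total n zero ≡ 1
total-zero zero    = refl
total-zero (suc n) = trans (total-suc-zero n) (total-zero n)

pairTotal : ℕ → ℕ → ℕ
pairTotal zero    k       = total zero k
pairTotal (suc n) zero    = total (suc n) zero
pairTotal (suc n) (suc k) = total (suc n) (suc k) + total n k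

pairTotal-pascal : ∀ n k → pairTotal n k + pairTotal n (suc k) ≡ pairTotal (suc n) (suc k)
pairTotal-pascal zero k = begin
  total 0 k + total 0 (suc k)   ≡⟨ +-comm (total 0 k) _ ⟩
  total 0 (suc k) + total 0 k   ≡⟨ cong (_+ total 0 k) (total-suc-suc 0 k) ⟨
  total 1 (suc k) + total 0 k   ∎
pairTotal-pascal (suc n) zero = begin
  total (suc n) 0 + (total (suc n) 1 + total n 0)
    ≡⟨ cong (λ t → total (suc n) 0 + (total (suc n) 1 + t)) (gapTotal-suc-zero n) ⟨
  total (suc n) 0 + (total (suc n) 1 + gapTotal (suc n) 0)
    ≡⟨ +-comm (total (suc n) 0) _ ⟩
  total (suc n) 1 + gapTotal (suc n) 0 + total (suc n) 0
    ≡⟨ cong (_+ total (suc n) 0) (total-suc-suc (suc n) 0) ⟨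
  total (suc (suc n)) 1 + total (suc n) 0 ∎
pairTotal-pascal (suc n) (suc k) = begin
  total (suc n) (suc k) + total n k + (total (suc n) (suc (suc k)) + total n (suc k))
    ≡⟨ rearrange (total (suc n) (suc k)) (total n k) (total (suc n) (suc (suc k))) (total n (suc k)) ⟩
  total (suc n) (suc (suc k)) + (total n (suc k) + total n k) + total (suc n) (suc k)
    ≡⟨ cong (λ t → total (suc n) (suc (suc k)) + t + total (suc n) (suc k)) (gapTotal-suc-suc n k) ⟨
  total (suc n) (suc (suc k)) + gapTotal (suc n) (suc k) + total (suc n) (suc k)
    ≡⟨ cong (_+ total (suc n) (suc k)) (total-suc-suc (suc n) (suc k)) ⟨
  total (suc (suc n)) (suc (suc k)) + total (suc n) (suc k) ∎
  where
  rearrange : ∀ a b c d → a + b + (c + d) ≡ c + (d + b) + a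
  rearrange = solve-∀

binomial≡pairTotal : ∀ n k → n C k ≡ pairTotal n k
binomial≡pairTotal zero    zero    = refl
binomial≡pairTotal zero    (suc k) = refl
binomial≡pairTotal (suc n) zero    = sym (total-zero (suc n))
binomial≡pairTotal (suc n) (suc k) = begin
  suc n C suc k               ≡⟨ nCk+nC[k+1]≡[n+1]C[k+1] n k ⟨
  n C k + n C suc k           ≡⟨ cong₂ _+_ (binomial≡pairTotal n k) (binomial≡pairTotal n (suc k)) ⟩
  pairTotal n k + pairTotal n (suc k) ≡⟨ pairTotal-pascal n k ⟩
  pairTotal (suc n) (suc k)   ∎

data Ascending : ℕ → List Placement → Set where
  []  : ∀ {o} → Ascending o []
  _∷_ : ∀ {o i b ps} → o ≤ i → Ascending (suc i) ps → Ascending o ((i , b) ∷ ps)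

ascending-weaken : ∀ {o o' ps} → o ≤ o' → Ascending o' ps → Ascending o ps
ascending-weaken o≤o' []           = []
ascending-weaken o≤o' (o'≤i ∷ ps) = ≤-trans o≤o' o'≤i ∷ ps

covers-start : ∀ i b → covers (i , b) i ≡ true
covers-start zero    false = refl
covers-start zero    true  = refl
covers-start (suc i) false = covers-start i false
covers-start (suc i) true  = covers-start i true

covers-below : ∀ {c i} b → c < i → covers (i , b) c ≡ false
covers-below {zero}  {suc i} false _         = refl
covers-below {zero}  {suc i} true  _         = refl
covers-below {suc c} {suc i} false (s≤s c<i) = covers-below false c<i
covers-below {suc c} {suc i} true  (s≤s c<i) = covers-below true c<i

covers-shift : ∀ o b j → covers (o , b) (o + j) ≡ covers (0 , b) j
covers-shift zero    b     j = refl
covers-shift (suc o) false j = covers-shift o false j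
covers-shift (suc o) true  j = covers-shift o true j

indicator : Bool → ℕ
indicator b = if b then 1 else 0

hits : Placement → ℕ → ℕ
hits p c = indicator (covers p c)

coverCount-∷ : ∀ p ps c → coverCount (p ∷ ps) c ≡ hits p c + coverCount ps c
coverCount-∷ p ps c with covers p c
... | true  = refl
... | false = refl

coverCount-below : ∀ {o c ps} → Ascending o ps → c < o → coverCount ps c ≡ 0
coverCount-below [] c<o = refl
coverCount-below {c = c} (_∷_ {i = i} {b} {ps} o≤i asc) c<o = begin
  coverCount ((i , b) ∷ ps) c ≡⟨ coverCount-∷ (i , b) ps c ⟩
  hits (i , b) c + coverCount ps c
    ≡⟨ cong₂ (λ h r → indicator h + r) (covers-below b (<-≤-trans c<o o≤i))
                                       (coverCount-below asc (<-trans c<o (s≤s o≤i))) ⟩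
  0 ∎

coverCount-start : ∀ i b ps → coverCount ((i , b) ∷ ps) i ≡ suc (coverCount ps i)
coverCount-start i b ps =
  trans (coverCount-∷ (i , b) ps i) (cong (λ h → indicator h + coverCount ps i) (covers-start i b))

ascending-skip : ∀ {o ps} → Ascending o ps → coverCount ps o ≡ 0 → Ascending (suc o) ps
ascending-skip [] _ = []
ascending-skip {o} (_∷_ {b = b} {ps} o≤i asc) uncovered with m≤n⇒m<n∨m≡n o≤i
... | inj₁ o<i  = o<i ∷ asc
... | inj₂ refl = ⊥-elim (1+n≢0 (trans (sym (coverCount-start o b ps)) uncovered))

record Exact (need : ℕ → ℕ) (o L : ℕ) (ps : List Placement) : Set where
  constructor exactly
  field
    at : ∀ {j} → o + j < L → coverCount ps (o + j) ≡ need j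

open Exact

infixr 5 _◂_
_◂_ : ℕ → (ℕ → ℕ) → ℕ → ℕ
(m ◂ need) zero    = m
(m ◂ need) (suc j) = need j

exact-cong : ∀ {f g o L ps} → (∀ j → f j ≡ g j) → Exact f o L ps → Exact g o L ps
exact-cong f≗g exact = exactly λ o+j<L → trans (at exact o+j<L) (f≗g _)

exact-head : ∀ {need o L ps} → Exact need o L ps → o < L → coverCount ps o ≡ need 0
exact-head {need} {o} {L} {ps} exact o<L =
  subst (λ c → coverCount ps c ≡ need 0) (+-identityʳ o)
        (at exact (subst (_< L) (sym (+-identityʳ o)) o<L))

exact-tail : ∀ {need o L ps} → Exact need o L ps → Exact (need ∘ suc) (suc o) L ps
exact-tail {need} {o} {L} {ps} exact = exactly λ {j} 1+o+j<L →
  subst (λ c → coverCount ps c ≡ need (suc j)) (+-suc o j)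
        (at exact (subst (_< L) (sym (+-suc o j)) 1+o+j<L))

exact-◂ : ∀ {m need o L ps} → (o < L → coverCount ps o ≡ m) → Exact need (suc o) L ps →
          Exact (m ◂ need) o L ps
exact-◂ {m} {need} {o} {L} {ps} head tail = exactly cell
  where
  cell : ∀ {j} → o + j < L → coverCount ps (o + j) ≡ (m ◂ need) j
  cell {zero} o+0<L =
    subst (λ c → coverCount ps c ≡ m) (sym (+-identityʳ o)) (head (subst (_< L) (+-identityʳ o) o+0<L))
  cell {suc j} o+1+j<L =
    subst (λ c → coverCount ps c ≡ need j) (sym (+-suc o j))
          (at tail (subst (_< L) (+-suc o j) o+1+j<L))

coverCount-tile : ∀ o b ys j → coverCount ((o , b) ∷ ys) (o + j) ≡ hits (0 , b) j + coverCount ys (o + j)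
coverCount-tile o b ys j = trans (coverCount-∷ (o , b) ys (o + j))
                                 (cong (λ h → indicator h + coverCount ys (o + j)) (covers-shift o b j))

exact-tile : ∀ {need o L b ys} →
  Exact (λ j → hits (0 , b) j + need j) o L ((o , b) ∷ ys) → Exact need o L ys
exact-tile {o = o} {b = b} {ys} exact = exactly λ {j} o+j<L →
  +-cancelˡ-≡ (hits (0 , b) j) _ _ (trans (sym (coverCount-tile o b ys j)) (at exact o+j<L))

exact-∷ : ∀ {need o L b ys} →
  Exact need o L ys → Exact (λ j → hits (0 , b) j + need j) o L ((o , b) ∷ ys)
exact-∷ {o = o} {b = b} {ys} exact = exactly λ {j} o+j<L →
  trans (coverCount-tile o b ys j) (cong (hits (0 , b) j +_) (at exact o+j<L))

exact-skip : ∀ {need o L ys} → Ascending o ys → o < L → Exact (0 ◂ need) o L ys →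
             Ascending (suc o) ys × Exact need (suc o) L ys
exact-skip asc o<L exact = ascending-skip asc (exact-head exact o<L) , exact-tail exact

exact-unskip : ∀ {need o L ys} → Ascending (suc o) ys → Exact need (suc o) L ys →
               Exact (0 ◂ need) o L ys
exact-unskip asc = exact-◂ (λ _ → coverCount-below asc ≤-refl)

demand : Bool → ℕ → ℕ
demand false = const 1
demand true  = 1 ◂ 0 ◂ const 1

demand-zero : ∀ gap → demand gap 0 ≡ 1
demand-zero false = refl
demand-zero true  = refl

-- Tiling gap o k L ps: the tiles ps, listed by increasing start, start at cell o or later, lie on
-- the 1×L board, include k fences and cover every cell of [o, L) exactly once, except that when
-- gap is set cell o + 1 is precovered and must not be covered again. Tiling false 0 is the
-- condition of the statement; Tiling false o and Tiling true o are counted by tilings and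
-- gapTilings of L - o cells.
record Tiling (gap : Bool) (o k L : ℕ) (ps : List Placement) : Set where
  constructor tiling
  field
    ascending  : Ascending o ps
    onBoard    : All (T ∘ inBoard L) ps
    exact      : Exact (demand gap) o L ps
    fences     : numFences ps ≡ k
    gapOnBoard : T gap → suc o < L

fence-inBoard : ∀ {o L} → T (inBoard L (o , true)) → suc (suc o) < L
fence-inBoard {o} {L} inside = subst (_< L) (+-comm o 2) (<ᵇ⇒< (o + 2) L inside)

inBoard-fence : ∀ {o L} → suc (suc o) < L → T (inBoard L (o , true))
inBoard-fence {o} {L} 2+o<L = <⇒<ᵇ (subst (_< L) (+-comm 2 o) 2+o<L)

-- Each transition below places the first tile at o. Its split writes the current demand as that
-- tile's footprint plus the remaining demand, which starts with zeros for cell o and for any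
-- following cells already complete; the next state starts after them.
square-free : ∀ {o k L} → o < L →
  (λ ys → Tiling false o k L ((o , false) ∷ ys)) ≐ Tiling false (suc o) k L
square-free {o} {k} {L} o<L = to , from
  where
  split : ∀ j → demand false j ≡ hits (0 , false) j + (0 ◂ demand false) j
  split zero    = refl
  split (suc j) = refl
  to : ∀ {ys} → Tiling false o k L ((o , false) ∷ ys) → Tiling false (suc o) k L ys
  to (tiling (_ ∷ asc) (_ ∷ board) exact fences _) =
    tiling asc board (exact-tail (exact-tile (exact-cong split exact))) fences λ ()
  from : ∀ {ys} → Tiling false (suc o) k L ys → Tiling false o k L ((o , false) ∷ ys)
  from (tiling asc board exact fences _) =
    tiling (≤-refl ∷ asc) (<⇒<ᵇ o<L ∷ board)
           (exact-cong (sym ∘ split) (exact-∷ (exact-unskip asc exact))) fences λ ()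

fence-free : ∀ {o k L} →
  (λ ys → Tiling false o (suc k) L ((o , true) ∷ ys)) ≐ Tiling true (suc o) k L
fence-free {o} {k} {L} = to , from
  where
  split : ∀ j → demand false j ≡ hits (0 , true) j + (0 ◂ demand true) j
  split zero                = refl
  split (suc zero)          = refl
  split (suc (suc zero))    = refl
  split (suc (suc (suc j))) = refl
  to : ∀ {ys} → Tiling false o (suc k) L ((o , true) ∷ ys) → Tiling true (suc o) k L ys
  to (tiling (_ ∷ asc) (inside ∷ board) exact fences _) =
    tiling asc board (exact-tail (exact-tile (exact-cong split exact))) (suc-injective fences)
           λ _ → fence-inBoard inside
  from : ∀ {ys} → Tiling true (suc o) k L ys → Tiling false o (suc k) L ((o , true) ∷ ys)
  from (tiling asc board exact fences gapOnBoard) =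
    tiling (≤-refl ∷ asc) (inBoard-fence (gapOnBoard _) ∷ board)
           (exact-cong (sym ∘ split) (exact-∷ (exact-unskip asc exact))) (cong suc fences) λ ()

square-gap : ∀ {o k L} → suc o < L →
  (λ ys → Tiling true o k L ((o , false) ∷ ys)) ≐ Tiling false (2 + o) k L
square-gap {o} {k} {L} 1+o<L = to , from
  where
  split : ∀ j → demand true j ≡ hits (0 , false) j + (0 ◂ 0 ◂ demand false) j
  split zero          = refl
  split (suc zero)    = refl
  split (suc (suc j)) = refl
  to : ∀ {ys} → Tiling true o k L ((o , false) ∷ ys) → Tiling false (2 + o) k L ys
  to (tiling (_ ∷ asc) (_ ∷ board) exact fences _) =
    let asc₂ , exact₂ = exact-skip asc 1+o<L (exact-tail (exact-tile (exact-cong split exact)))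
    in tiling asc₂ board exact₂ fences λ ()
  from : ∀ {ys} → Tiling false (2 + o) k L ys → Tiling true o k L ((o , false) ∷ ys)
  from (tiling asc board exact fences _) =
    tiling (≤-refl ∷ ascending-weaken (n≤1+n _) asc) (<⇒<ᵇ (<-trans (n<1+n o) 1+o<L) ∷ board)
           (exact-cong (sym ∘ split)
              (exact-∷ (exact-unskip (ascending-weaken (n≤1+n _) asc) (exact-unskip asc exact))))
           fences λ _ → 1+o<L

fence-gap : ∀ {o k L} → suc (suc o) < L →
  (λ ys → Tiling true o (suc k) L ((o , true) ∷ ys)) ≐ Tiling false (3 + o) k L
fence-gap {o} {k} {L} 2+o<L = to , from
  where
  split : ∀ j → demand true j ≡ hits (0 , true) j + (0 ◂ 0 ◂ 0 ◂ demand false) j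
  split zero                = refl
  split (suc zero)          = refl
  split (suc (suc zero))    = refl
  split (suc (suc (suc j))) = refl
  to : ∀ {ys} → Tiling true o (suc k) L ((o , true) ∷ ys) → Tiling false (3 + o) k L ys
  to (tiling (_ ∷ asc) (_ ∷ board) exact fences _) =
    let asc₂ , exact₂ = exact-skip asc (<-trans (n<1+n _) 2+o<L)
                          (exact-tail (exact-tile (exact-cong split exact)))
        asc₃ , exact₃ = exact-skip asc₂ 2+o<L exact₂
    in tiling asc₃ board exact₃ (suc-injective fences) λ ()
  from : ∀ {ys} → Tiling false (3 + o) k L ys → Tiling true o (suc k) L ((o , true) ∷ ys)
  from (tiling asc board exact fences _) =
    tiling (≤-refl ∷ asc₁) (inBoard-fence 2+o<L ∷ board)
           (exact-cong (sym ∘ split)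
              (exact-∷ (exact-unskip asc₁ (exact-unskip asc₂ (exact-unskip asc exact)))))
           (cong suc fences) λ _ → <-trans (n<1+n _) 2+o<L
    where
    asc₂ = ascending-weaken (n≤1+n _) asc
    asc₁ = ascending-weaken (n≤1+n _) asc₂

first-tile : ∀ {gap o k L i b ys} → Tiling gap o k L ((i , b) ∷ ys) → o < L → i ≡ o
first-tile {gap} {o} {i = i} {b} {ys} (tiling (o≤i ∷ asc) _ exact _ _) o<L with m≤n⇒m<n∨m≡n o≤i
... | inj₂ o≡i = sym o≡i
... | inj₁ o<i = ⊥-elim (0≢1+n (begin
  0                                 ≡⟨ coverCount-below (_∷_ {b = b} o<i asc) ≤-refl ⟨
  coverCount ((i , b) ∷ ys) o       ≡⟨ exact-head exact o<L ⟩
  demand gap 0                      ≡⟨ demand-zero gap ⟩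
  1                                 ∎))

uncovered-cell : ∀ {gap o k L} → Tiling gap o k L [] → ¬ o < L
uncovered-cell {gap} t o<L = 0≢1+n (trans (exact-head (Tiling.exact t) o<L) (demand-zero gap))

tile-off-board : ∀ {gap o k L p ys} → L ≤ o → ¬ Tiling gap o k L (p ∷ ys)
tile-off-board {p = i , b} L≤o (tiling (o≤i ∷ _) (inside ∷ _) _ _ _) =
  <⇒≱ (inBoard⇒start< {b = b} inside) (≤-trans L≤o o≤i)
  where
  inBoard⇒start< : ∀ {L i b} → T (inBoard L (i , b)) → i < L
  inBoard⇒start< {L} {i} {false} inside = <ᵇ⇒< i L inside
  inBoard⇒start< {L} {i} {true}  inside = <-trans (m<m+n i (s≤s z≤n)) (<ᵇ⇒< (i + 2) L inside)

empty-tiling : ∀ {o L} → L ≤ o → Tiling false o 0 L []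
empty-tiling {o} L≤o =
  tiling [] [] (exactly λ {j} o+j<L → ⊥-elim (<⇒≱ o+j<L (≤-trans L≤o (m≤m+n o j)))) refl λ ()

ascending? : ∀ o ps → Dec (Ascending o ps)
ascending? o []            = yes []
ascending? o ((i , b) ∷ ps) =
  map′ (uncurry _∷_) (λ { (o≤i ∷ asc) → o≤i , asc }) (o ≤? i ×-dec ascending? (suc i) ps)

exact? : ∀ need o L ps → Dec (Exact need o L ps)
exact? need o L ps = map′ from to
  (allUpTo? (λ j → o + j <? L →-dec coverCount ps (o + j) ≟ need j) L)
  where
  Bounded = ∀ {j} → j < L → o + j < L → coverCount ps (o + j) ≡ need j
  from : Bounded → Exact need o L ps
  from bounded = exactly λ {j} o+j<L → bounded (≤-trans (s≤s (m≤n+m j o)) o+j<L) o+j<L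
  to : Exact need o L ps → Bounded
  to exact _ = at exact

tiling? : ∀ gap o k L → Decidable (Tiling gap o k L)
tiling? gap o k L ps =
  map′ (λ (asc , board , exact , fences , gapOnBoard) → tiling asc board exact fences gapOnBoard)
       (λ (tiling asc board exact fences gapOnBoard) → asc , board , exact , fences , gapOnBoard)
       (ascending? o ps ×-dec all? (T? ∘ inBoard L) ps ×-dec exact? (demand gap) o L ps ×-dec
        numFences ps ≟ k ×-dec (T? gap →-dec suc o <? L))

increasing-∷ : ∀ i b ps → T (increasing ((i , b) ∷ ps)) ⇔ Ascending (suc i) ps
increasing-∷ i b []               = mk⇔ (const []) (const tt)
increasing-∷ i b ((j , c) ∷ ps) = mk⇔
  (λ t → let i<j , rest = Equivalence.to T-∧ t
         in <ᵇ⇒< i j i<j ∷ Equivalence.to (increasing-∷ j c ps) rest)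
  (λ { (i<j ∷ asc) → Equivalence.from T-∧ (<⇒<ᵇ i<j , Equivalence.from (increasing-∷ j c ps) asc) })

increasing⇔ascending : ∀ ps → T (increasing ps) ⇔ Ascending 0 ps
increasing⇔ascending []              = mk⇔ (const []) (const tt)
increasing⇔ascending ((i , b) ∷ ps) = mk⇔
  (λ t → z≤n ∷ Equivalence.to (increasing-∷ i b ps) t)
  (λ { (_ ∷ asc) → Equivalence.from (increasing-∷ i b ps) asc })

canonical≐tiling : ∀ k L →
  (λ ps → T (increasing ps ∧ isTiling L ps ∧ (numFences ps ≡ᵇ k))) ≐ Tiling false 0 k L
canonical≐tiling k L = to , from
  where
  to : ∀ {ps} → T (increasing ps ∧ isTiling L ps ∧ (numFences ps ≡ᵇ k)) → Tiling false 0 k L ps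
  to {ps} t =
    let inc , rest     = Equivalence.to (T-∧ {increasing ps}) t
        tiles , fences = Equivalence.to (T-∧ {isTiling L ps}) rest
        board , once   = Equivalence.to (T-∧ {all (inBoard L) ps}) tiles
    in tiling (Equivalence.to (increasing⇔ascending ps) inc) (all⁺ (inBoard L) ps board)
              (exactly λ j<L → ≡ᵇ⇒≡ _ 1 (applyUpTo⁻ id L (all⁺ _ (upTo L) once) j<L))
              (≡ᵇ⇒≡ _ k fences) λ ()
  from : ∀ {ps} → Tiling false 0 k L ps → T (increasing ps ∧ isTiling L ps ∧ (numFences ps ≡ᵇ k))
  from {ps} (tiling asc board exact fences _) = Equivalence.from (T-∧ {increasing ps})
    ( Equivalence.from (increasing⇔ascending ps) asc
    , Equivalence.from (T-∧ {isTiling L ps})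
        ( Equivalence.from (T-∧ {all (inBoard L) ps})
            (all⁻ (inBoard L) board , all⁻ _ (applyUpTo⁺₁ id L (λ j<L → ≡⇒≡ᵇ _ 1 (at exact j<L))))
        , ≡⇒≡ᵇ _ k fences))

module Counting (L : ℕ) where

  placements : List Placement
  placements = placementsOn L

  countTilings : Bool → ℕ → ℕ → ℕ → ℕ
  countTilings gap o n k = countLists (tiling? gap o k L) n placements

  countTilingsWith : Placement → Bool → ℕ → ℕ → ℕ
  countTilingsWith p gap n k = countLists (λ ys → tiling? gap (proj₁ p) k L (p ∷ ys)) n placements

  count-split : ∀ {gap o} n k → o < L →
    countTilings gap o (suc n) k ≡ countTilingsWith (o , false) gap n k + countTilingsWith (o , true) gap n k
  count-split {gap} {o} n k o<L = countLists-startingAt (tiling? gap o k L) o<L (λ t → first-tile t o<L) n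

  countTilingsWith-fence-zero : ∀ {gap o} n → countTilingsWith (o , true) gap n 0 ≡ 0
  countTilingsWith-fence-zero n = countLists-none _ (λ { _ (tiling _ _ _ () _) }) n placements

  private
    board-end : ∀ {o} → o + 0 ≡ L → L ≤ o
    board-end {o} eq = ≤-reflexive (trans (sym eq) (+-identityʳ o))

    first-cell : ∀ {o d} → o + suc d ≡ L → o < L
    first-cell {o} {d} eq = subst (o <_) eq (m<m+n o (s≤s z≤n))

    shift : ∀ {o d} → o + suc d ≡ L → suc o + d ≡ L
    shift {o} {d} eq = trans (sym (+-suc o d)) eq

    shift₂ : ∀ {o d} → o + suc (suc d) ≡ L → 2 + o + d ≡ L
    shift₂ {o} {d} eq = shift {suc o} {d} (shift {o} {suc d} eq)

    shift₃ : ∀ {o d} → o + suc (suc (suc d)) ≡ L → 3 + o + d ≡ L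
    shift₃ {o} {d} eq = shift₂ {suc o} {d} (shift {o} {suc (suc d)} eq)

    second-cell : ∀ {o d} → o + suc (suc d) ≡ L → suc o < L
    second-cell {o} {d} eq = first-cell {suc o} {d} (shift {o} {suc d} eq)

    third-cell : ∀ {o d} → o + suc (suc (suc d)) ≡ L → suc (suc o) < L
    third-cell {o} {d} eq = first-cell {suc (suc o)} {d} (shift₂ {o} {suc d} eq)

    no-room : ∀ {o d k ys} → d ≤ 1 → o + d ≡ L → ¬ Tiling true o k L ys
    no-room {o} {d} d≤1 eq t =
      <⇒≱ (Tiling.gapOnBoard t _) (subst (_≤ suc o) eq (subst (o + d ≤_) (+-comm o 1) (+-monoʳ-≤ o d≤1)))

  mutual
    count-free : ∀ {o d} n k → o + d ≡ L → countTilings false o n k ≡ tilings d n k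
    count-free {o} {zero} zero zero eq = countLists-[] (tiling? false o 0 L) (empty-tiling (board-end eq)) placements
    count-free {o} {zero} zero (suc k) eq =
      countLists-¬[] (tiling? false o (suc k) L) (λ { (tiling _ _ _ () _) }) placements
    count-free {o} {zero} (suc n) k eq =
      countLists-¬∷ (tiling? false o k L) (tile-off-board (board-end eq)) n placements
    count-free {o} {suc d} zero k eq =
      countLists-¬[] (tiling? false o k L) (λ t → uncovered-cell t (first-cell eq)) placements
    count-free {o} {suc d} (suc n) zero eq = begin
      countTilings false o (suc n) 0
        ≡⟨ count-split n 0 (first-cell eq) ⟩
      countTilingsWith (o , false) false n 0 + countTilingsWith (o , true) false n 0
        ≡⟨ cong₂ _+_ (countLists-≐ _ _ (square-free (first-cell eq)) n placements)
                     (countTilingsWith-fence-zero n) ⟩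
      countTilings false (suc o) n 0 + 0
        ≡⟨ +-identityʳ _ ⟩
      countTilings false (suc o) n 0
        ≡⟨ count-free n 0 (shift eq) ⟩
      tilings d n 0 ∎
    count-free {o} {suc d} (suc n) (suc k) eq = begin
      countTilings false o (suc n) (suc k)
        ≡⟨ count-split n (suc k) (first-cell eq) ⟩
      countTilingsWith (o , false) false n (suc k) + countTilingsWith (o , true) false n (suc k)
        ≡⟨ cong₂ _+_ (countLists-≐ _ _ (square-free (first-cell eq)) n placements)
                     (countLists-≐ _ _ fence-free n placements) ⟩
      countTilings false (suc o) n (suc k) + countTilings true (suc o) n k
        ≡⟨ cong₂ _+_ (count-free n (suc k) (shift eq)) (count-gap n k (shift eq)) ⟩
      tilings d n (suc k) + gapTilings d n k ∎

    count-gap : ∀ {o d} n k → o + d ≡ L → countTilings true o n k ≡ gapTilings d n k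
    count-gap {o} {zero}     n k eq = countLists-none (tiling? true o k L) (λ _ → no-room z≤n eq) n placements
    count-gap {o} {suc zero} n k eq = countLists-none (tiling? true o k L) (λ _ → no-room ≤-refl eq) n placements
    count-gap {o} {suc (suc d)} zero k eq =
      countLists-¬[] (tiling? true o k L) (λ t → uncovered-cell t (first-cell eq)) placements
    count-gap {o} {suc (suc d)} (suc n) zero eq = begin
      countTilings true o (suc n) 0
        ≡⟨ count-split n 0 (first-cell eq) ⟩
      countTilingsWith (o , false) true n 0 + countTilingsWith (o , true) true n 0
        ≡⟨ cong₂ _+_ (countLists-≐ _ _ (square-gap (second-cell eq)) n placements)
                     (countTilingsWith-fence-zero n) ⟩
      countTilings false (2 + o) n 0 + 0
        ≡⟨ +-identityʳ _ ⟩
      countTilings false (2 + o) n 0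
        ≡⟨ count-free n 0 (shift₂ eq) ⟩
      tilings d n 0 ∎
    count-gap {o} {suc (suc zero)} (suc n) (suc k) eq = begin
      countTilings true o (suc n) (suc k)
        ≡⟨ count-split n (suc k) (first-cell eq) ⟩
      countTilingsWith (o , false) true n (suc k) + countTilingsWith (o , true) true n (suc k)
        ≡⟨ cong₂ _+_ (countLists-≐ _ _ (square-gap (second-cell eq)) n placements)
                     (countLists-none _ (λ _ → fence-off-board) n placements) ⟩
      countTilings false (2 + o) n (suc k) + 0
        ≡⟨ +-identityʳ _ ⟩
      countTilings false (2 + o) n (suc k)
        ≡⟨ count-free n (suc k) (shift₂ eq) ⟩
      tilings zero n (suc k) ∎
      where
      fence-off-board : ∀ {ys} → ¬ Tiling true o (suc k) L ((o , true) ∷ ys)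
      fence-off-board (tiling _ (inside ∷ _) _ _ _) = <-irrefl (trans (+-comm 2 o) eq) (fence-inBoard inside)
    count-gap {o} {suc (suc (suc d))} (suc n) (suc k) eq = begin
      countTilings true o (suc n) (suc k)
        ≡⟨ count-split n (suc k) (first-cell eq) ⟩
      countTilingsWith (o , false) true n (suc k) + countTilingsWith (o , true) true n (suc k)
        ≡⟨ cong₂ _+_ (countLists-≐ _ _ (square-gap (second-cell eq)) n placements)
                     (countLists-≐ _ _ (fence-gap (third-cell eq)) n placements) ⟩
      countTilings false (2 + o) n (suc k) + countTilings false (3 + o) n k
        ≡⟨ cong₂ _+_ (count-free n (suc k) (shift₂ eq)) (count-free n k (shift₃ eq)) ⟩
      tilings (suc d) n (suc k) + tilings d n k ∎

tilingsOn-length : ∀ n k L → length (tilingsOn n k L) ≡ tilings L n k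
tilingsOn-length n k L = begin
  length (tilingsOn n k L)
    ≡⟨ countLists-≐ _ (tiling? false 0 k L) (canonical≐tiling k L) n (placementsOn L) ⟩
  Counting.countTilings L false 0 n k
    ≡⟨ Counting.count-free L n k refl ⟩
  tilings L n k ∎

tilingCount≡total : ∀ n k → tilingCount n k ≡ total n k
tilingCount≡total n k =
  trans (sumOver-applyUpTo (λ L → length (tilingsOn n k L)) id (suc (n + n)))
        (sumTo-cong (suc (n + n)) (λ L → tilingsOn-length n k L))

mainTheorem20 : (n k : ℕ) → 0 < k → k ≤ n →
    n C k ≡ tilingCount n k + tilingCount (n ∸ 1) (k ∸ 1)
mainTheorem20 (suc n) (suc k) _ _ = begin
  suc n C suc k
    ≡⟨ binomial≡pairTotal (suc n) (suc k) ⟩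
  total (suc n) (suc k) + total n k
    ≡⟨ cong₂ _+_ (tilingCount≡total (suc n) (suc k)) (tilingCount≡total n k) ⟨
  tilingCount (suc n) (suc k) + tilingCount n k ∎
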